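{- Let $\vec x=x_1,\dots,x_n$ and let $\vec x.s$, $\vec x.t$, $\vec x.u$ be terms with $\vec x.t$ and $\vec x.u$ expanded. If $\vec x.s\trianglerighteq_E\vec x.t$, $\vec x.t\trianglerighteq_E\vec x.u$, and $\varnothing\ne\mathrm{fv}(v)\subseteq\{\vec x\}$ for $v\in\{t,u\}$, then $\vec x.s\trianglerighteq_E\vec x.u$.
   Context: Terms are simply-typed $\lambda$-terms in $\beta\eta$-long normal form. Types are sorts $a$ or $(\sigma_1,\dots,\sigma_n)\to a$. There are typed variables, infinitely many of each type, and typed function symbols $\mathcal{F}$. Terms are generated as follows. If a head $h$ (function symbol or variable) has type $(\sigma_1,\dots,\sigma_n)\to a$ and $t_i:\sigma_i$, then $h(t_1,\dots,t_n):a$. If $t:a$ and $x_i:\sigma_i$, then $x_1,\dots,x_n.t:(\sigma_1,\dots,\sigma_n)\to a$. Terms are taken modulo $\alpha$-renaming, and bound variables are distinct and never free. $\mathrm{fv}$ denotes free variables. $x{\downarrow}=y_1,\dots,y_n.x(y_1{\downarrow},\dots,y_n{\downarrow})$ is the $\eta$-expansion of $x:(\sigma_1,\dots,\sigma_n)\to a$. Subterms: $\vec x.h(s_1,\dots,s_m)\trianglerighteq t$ iff the two are equal or $\vec x.s_i\trianglerighteq t$ for some $i$, where if $s_i=\vec z.s'_i$ then $\vec x.s_i$ denotes $\vec x,\vec z.s'_i$. Expanded terms: $\vec x.s$ is expanded if it equals $\vec x,y_1,\dots,y_k.h(s_1,\dots,s_m,y_1{\downarrow},\dots,y_k{\downarrow})$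 with $(\bigcup_i\mathrm{fv}(s_i)\cup\{h\})\cap\{\vec y\}=\varnothing$. Expanded subterms: for $\vec x=x_1,\dots,x_n$, a term $\vec x.s$, and an expanded term $\vec x.t=\vec x,y_1,\dots,y_k.h(t_1,\dots,t_m,y_1{\downarrow},\dots,y_k{\downarrow})$, we write $\vec x.s\trianglerighteq_E\vec x.t$ iff there are $n'\ge n$ and terms $x_1,\dots,x_{n'}.t_{m+1},\dots,x_1,\dots,x_{n'}.t_{m+k}$ with $\vec x.s\trianglerighteq x_1,\dots,x_{n'}.h(t_1,\dots,t_{m+k})$. -}

module Defs where

open import Data.List using (List; []; _∷_; _++_)
open import Data.List.Membership.Propositional using (_∈_; _∉_)
open import Data.List.Membership.Propositional.Properties using (∈-++⁺ˡ; ∈-++⁺ʳ; ∈-++⁻)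
open import Data.List.Relation.Unary.Any using (here; there)
open import Data.Product using (Σ; ∃; _×_; _,_)
open import Data.Sum using (inj₁; inj₂)
open import Data.Unit using (⊤)
open import Data.Empty using (⊥)
open import Relation.Binary.PropositionalEquality using (_≡_; refl)

-- Simple types over a set of sorts S.
-- A sort a is represented as ([] ⇒ a); (σ₁,…,σₙ) → a as (σ₁ ∷ … ∷ σₙ ∷ []) ⇒ a.

data Ty (S : Set) : Set where
  _⇒_ : List (Ty S) → S → Ty S

dom : ∀ {S} → Ty S → List (Ty S)
dom (σs ⇒ _) = σs

cod : ∀ {S} → Ty S → S
cod (_ ⇒ a) = a

record Signature : Set₁ where
  field
    Sort  : Set
    Fun   : Set
    fty   : Fun → Ty Sort
    V     : Set
    vty   : V → Ty Sort
    -- infinitely many variables of each type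
    fresh : (τ : Ty Sort) (vs : List V) → Σ V (λ v → vty v ≡ τ × v ∉ vs)

-- Terms in βη-long normal form, locally nameless:
-- bound variables are de Bruijn (positions in a list Δ of binder types,
-- binders in left-to-right order), free variables are named (V).
-- Modulo α-renaming is thus built in.

module Terms (Sg : Signature) where
  open Signature Sg public

  Type : Set
  Type = Ty Sort

  Ctx : Set
  Ctx = List Type

  data Head (Δ : Ctx) : Type → Set where
    var  : ∀ {τ} → τ ∈ Δ → Head Δ τ
    free : (v : V) → Head Δ (vty v)
    fun  : (f : Fun) → Head Δ (fty f)

  mutual
    data Nf (Δ : Ctx) (τ : Type) : Set where
      lam : Body (Δ ++ dom τ) (cod τ) → Nf Δ τ

    data Body (Δ : Ctx) : Sort → Set where
      app : ∀ {ρs a} → Head Δ (ρs ⇒ a) → Args Δ ρs → Body Δ a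

    data Args (Δ : Ctx) : List Type → Set where
      []  : Args Δ []
      _∷_ : ∀ {ρ ρs} → Nf Δ ρ → Args Δ ρs → Args Δ (ρ ∷ ρs)

  infixr 5 _++A_
  _++A_ : ∀ {Δ ρs σs} → Args Δ ρs → Args Δ σs → Args Δ (ρs ++ σs)
  [] ++A bs = bs
  (a ∷ as) ++A bs = a ∷ (as ++A bs)

  Ren : Ctx → Ctx → Set
  Ren Δ Δ' = ∀ {τ} → τ ∈ Δ → τ ∈ Δ'

  liftR : ∀ {Δ Δ'} σs → Ren Δ Δ' → Ren (Δ ++ σs) (Δ' ++ σs)
  liftR {Δ} {Δ'} σs r p with ∈-++⁻ Δ p
  ... | inj₁ q = ∈-++⁺ˡ (r q)
  ... | inj₂ q = ∈-++⁺ʳ Δ' q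

  renH : ∀ {Δ Δ' τ} → Ren Δ Δ' → Head Δ τ → Head Δ' τ
  renH r (var p) = var (r p)
  renH r (free v) = free v
  renH r (fun f) = fun f

  mutual
    renN : ∀ {Δ Δ' τ} → Ren Δ Δ' → Nf Δ τ → Nf Δ' τ
    renN {τ = τ} r (lam b) = lam (renB (liftR (dom τ) r) b)

    renB : ∀ {Δ Δ' a} → Ren Δ Δ' → Body Δ a → Body Δ' a
    renB r (app h as) = app (renH r h) (renA r as)

    renA : ∀ {Δ Δ' ρs} → Ren Δ Δ' → Args Δ ρs → Args Δ' ρs
    renA r [] = []
    renA r (t ∷ ts) = renN r t ∷ renA r ts

  wk : ∀ {Δ} Δ'' → Ren Δ (Δ ++ Δ'')
  wk Δ'' p = ∈-++⁺ˡ p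

  mutual
    eta : ∀ {Γ} τ → τ ∈ Γ → Nf Γ τ
    eta {Γ} (ρs ⇒ b) x = lam (app (var (∈-++⁺ˡ x)) (etas ρs (∈-++⁺ʳ Γ)))

    etas : ∀ {Γ} σs → (∀ {σ} → σ ∈ σs → σ ∈ Γ) → Args Γ σs
    etas [] f = []
    etas (σ ∷ σs) f = eta σ (f (here refl)) ∷ etas σs (λ p → f (there p))

  -- A term x⃗.r with r of a sort is represented as r : Body Δ a, Δ the
  -- types of the binders x⃗.

  mutual
    data _⊵_ : ∀ {Δ a Δ' b} → Body Δ a → Body Δ' b → Set where
      ⊵-refl : ∀ {Δ a} {s : Body Δ a} → s ⊵ s
      ⊵-arg  : ∀ {Δ a Δ' b ρs} {h : Head Δ (ρs ⇒ a)} {as : Args Δ ρs}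
                 {r : Body Δ' b} → ArgSub as r → app h as ⊵ r

    data ArgSub : ∀ {Δ ρs Δ' b} → Args Δ ρs → Body Δ' b → Set where
      here  : ∀ {Δ ρ ρs Δ' b} {s : Body (Δ ++ dom ρ) (cod ρ)} {as : Args Δ ρs}
                {r : Body Δ' b} → s ⊵ r → ArgSub (lam {τ = ρ} s ∷ as) r
      there : ∀ {Δ ρ ρs Δ' b} {t : Nf Δ ρ} {as : Args Δ ρs}
                {r : Body Δ' b} → ArgSub as r → ArgSub (t ∷ as) r

  bodyOf : ∀ {Δ τ} → Nf Δ τ → Body (Δ ++ dom τ) (cod τ)
  bodyOf (lam b) = b

  data Var (Δ : Ctx) : Set where
    bnd : ∀ {τ} → τ ∈ Δ → Var Δ
    fre : V → Var Δ

  liftV : ∀ {Δ} σs → Var Δ → Var (Δ ++ σs)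
  liftV σs (bnd p) = bnd (∈-++⁺ˡ p)
  liftV σs (fre v) = fre v

  data HeadIs : ∀ {Δ τ} → Head Δ τ → Var Δ → Set where
    isVar  : ∀ {Δ τ} {p : τ ∈ Δ} → HeadIs (var p) (bnd p)
    isFree : ∀ {Δ} {v : V} → HeadIs {Δ} (free v) (fre v)

  mutual
    data _∈B_ : ∀ {Δ a} → Var Δ → Body Δ a → Set where
      inHead : ∀ {Δ ρs a} {z : Var Δ} {h : Head Δ (ρs ⇒ a)} {as : Args Δ ρs}
                 → HeadIs h z → z ∈B app h as
      inArgs : ∀ {Δ ρs a} {z : Var Δ} {h : Head Δ (ρs ⇒ a)} {as : Args Δ ρs}
                 → z ∈A as → z ∈B app h as

    data _∈A_ : ∀ {Δ ρs} → Var Δ → Args Δ ρs → Set where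
      here  : ∀ {Δ ρ ρs} {z : Var Δ} {s : Body (Δ ++ dom ρ) (cod ρ)} {as : Args Δ ρs}
                → liftV (dom ρ) z ∈B s → z ∈A (lam {τ = ρ} s ∷ as)
      there : ∀ {Δ ρ ρs} {z : Var Δ} {t : Nf Δ ρ} {as : Args Δ ρs}
                → z ∈A as → z ∈A (t ∷ as)

  -- z ∈ fv(t), for t with (free) variables x⃗ : Δ; t's own binders are bound
  _∈fv_ : ∀ {Δ τ} → Var Δ → Nf Δ τ → Set
  _∈fv_ {τ = τ} z (lam b) = liftV (dom τ) z ∈B b

  IsBinder : ∀ {Δ} → Var Δ → Set
  IsBinder (bnd _) = ⊤
  IsBinder (fre _) = ⊥

  FvNonemptyInBinders : ∀ {Δ τ} → Nf Δ τ → Set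
  FvNonemptyInBinders {Δ} t =
    Σ (Var Δ) (λ z → z ∈fv t) × (∀ (z : Var Δ) → z ∈fv t → IsBinder z)

  -- Expanded terms: x⃗.t = x⃗,y₁…yₖ.h(t₁,…,tₘ,y₁↓,…,yₖ↓) with h and the tᵢ
  -- not containing y⃗ (y⃗ = the binders of t, types dom τ).  Freshness of
  -- y⃗ is expressed by h, tᵢ being weakenings of a head / terms over x⃗.

  record ExpForm {Δ τ} (t : Nf Δ τ) : Set where
    constructor expForm
    field
      ρs  : List Type
      hd  : Head Δ ((ρs ++ dom τ) ⇒ cod τ)
      as  : Args Δ ρs
      eq  : t ≡ lam (app (renH (wk (dom τ)) hd)
                         (renA (wk (dom τ)) as ++A etas (dom τ) (∈-++⁺ʳ Δ)))

  Expanded : ∀ {Δ τ} → Nf Δ τ → Set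
  Expanded t = ExpForm t

  _⊵E_ : ∀ {Δ τ τ'} → Nf Δ τ → Nf Δ τ' → Set
  _⊵E_ {Δ} {τ} {τ'} s t =
    Σ (ExpForm t) λ e →
    Σ Ctx λ Δ'' →
    Σ (Args (Δ ++ Δ'') (dom τ')) λ rest →
      bodyOf s ⊵ app (renH (wk Δ'') (ExpForm.hd e))
                     (renA (wk Δ'') (ExpForm.as e) ++A rest)

{-# OPTIONS --safe #-}
-- Write t = x⃗,y⃗.h(t₁,…,tₘ,y⃗↓); by s ⊵E t, s contains x₁…x_{n'}.h(t₁,…,tₘ,r⃗). Follow the path
-- from the body of t to the subterm h'(u₁,…,u_k,…) given by t ⊵E u. It never enters a yⱼ↓, since
-- u mentions some xᵢ and no subterm of yⱼ↓ does. So either it stops at the top, where u₁,…,u_k,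
-- being weakenings of terms over x⃗, must be among t₁,…,tₘ, or it runs inside some tᵢ, which does
-- not mention y⃗. In both cases the same path inside h(t₁,…,tₘ,r⃗) ends at h'(u₁,…,u_k,…) over an
-- extension of x⃗. Variables on the two sides are matched by their position in the context, the
-- x⃗ always occupying the first positions.
module Submission where

open import Defs
open import Data.Empty using (⊥-elim)
open import Data.Fin using (toℕ)
open import Data.Fin.Properties using (toℕ<n)
open import Data.List using (List; []; _∷_; _++_; length)
open import Data.List.Properties using (++-assoc; length-++-≤ˡ)
open import Data.List.Membership.Propositional using (_∈_)
open import Data.List.Membership.Propositional.Properties using (∈-++⁺ˡ; ∈-++⁺ʳ; ∈-++⁻)
open import Data.List.Relation.Unary.Any using (here; there; index)
open import Data.List.Relation.Unary.Any.Properties using (++⁻∘++⁺; ++⁺∘++⁻)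
open import Data.Nat using (ℕ; suc; _≤_; _<_; z≤n; s≤s)
open import Data.Nat.Properties using (≤-trans; <⇒≱; suc-injective)
open import Data.Product using (Σ; ∃; ∃₂; _×_; _,_; proj₁; map₂)
open import Data.Sum using (_⊎_; inj₁; inj₂; [_,_]′)
open import Data.Sum.Properties using (inj₁-injective; inj₂-injective)
open import Relation.Nullary using (¬_)
open import Relation.Binary.PropositionalEquality

module _ {A : Set} where

  private variable
    x : A
    xs ys : List A

  data AppendView (xs : List A) {ys} : x ∈ xs ++ ys → Set where
    inˡ : (p : x ∈ xs) → AppendView xs (∈-++⁺ˡ p)
    inʳ : (p : x ∈ ys) → AppendView xs (∈-++⁺ʳ xs p)

  appendView : ∀ xs (p : x ∈ xs ++ ys) → AppendView xs p
  appendView xs p with ∈-++⁻ xs p | ++⁺∘++⁻ xs p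
  ... | inj₁ q | refl = inˡ q
  ... | inj₂ q | refl = inʳ q

  ∈-++⁺-injective : ∀ xs {p q : x ∈ xs ⊎ x ∈ ys} →
                    [ ∈-++⁺ˡ , ∈-++⁺ʳ xs ]′ p ≡ [ ∈-++⁺ˡ , ∈-++⁺ʳ xs ]′ q → p ≡ q
  ∈-++⁺-injective xs {p} {q} eq = begin
    p                                      ≡⟨ ++⁻∘++⁺ xs p ⟨
    ∈-++⁻ xs ([ ∈-++⁺ˡ , ∈-++⁺ʳ xs ]′ p)   ≡⟨ cong (∈-++⁻ xs) eq ⟩
    ∈-++⁻ xs ([ ∈-++⁺ˡ , ∈-++⁺ʳ xs ]′ q)   ≡⟨ ++⁻∘++⁺ xs q ⟩
    q                                      ∎
    where open ≡-Reasoning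

  ∈-++⁺ˡ-injective : {p q : x ∈ xs} → ∈-++⁺ˡ {ys = ys} p ≡ ∈-++⁺ˡ q → p ≡ q
  ∈-++⁺ˡ-injective {xs = xs} eq = inj₁-injective (∈-++⁺-injective xs {inj₁ _} {inj₁ _} eq)

  ∈-++⁺ʳ-injective : ∀ xs {p q : x ∈ ys} → ∈-++⁺ʳ xs p ≡ ∈-++⁺ʳ xs q → p ≡ q
  ∈-++⁺ʳ-injective xs eq = inj₂-injective (∈-++⁺-injective xs {inj₂ _} {inj₂ _} eq)

  ∈-++⁺ˡ≢∈-++⁺ʳ : {p : x ∈ xs} {q : x ∈ ys} → ¬ ∈-++⁺ˡ p ≡ ∈-++⁺ʳ xs q
  ∈-++⁺ˡ≢∈-++⁺ʳ {xs = xs} eq with ∈-++⁺-injective xs {inj₁ _} {inj₂ _} eq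
  ... | ()

  pos : x ∈ xs → ℕ
  pos p = toℕ (index p)

  pos<length : (p : x ∈ xs) → pos p < length xs
  pos<length p = toℕ<n (index p)

  pos-injective : {p q : x ∈ xs} → pos p ≡ pos q → p ≡ q
  pos-injective {p = here refl} {here refl} _  = refl
  pos-injective {p = there p}   {there q}   eq = cong there (pos-injective (suc-injective eq))

  pos-∈-++⁺ˡ : (p : x ∈ xs) → pos (∈-++⁺ˡ {ys = ys} p) ≡ pos p
  pos-∈-++⁺ˡ (here _)  = refl
  pos-∈-++⁺ˡ (there p) = cong suc (pos-∈-++⁺ˡ p)

  pos-∈-++⁺ˡ<length : (p : x ∈ xs) → pos (∈-++⁺ˡ {ys = ys} p) < length xs
  pos-∈-++⁺ˡ<length p = subst (_< _) (sym (pos-∈-++⁺ˡ p)) (pos<length p)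

  length≤pos-∈-++⁺ʳ : ∀ xs (p : x ∈ ys) → length xs ≤ pos (∈-++⁺ʳ xs p)
  length≤pos-∈-++⁺ʳ []       p = z≤n
  length≤pos-∈-++⁺ʳ (_ ∷ xs) p = s≤s (length≤pos-∈-++⁺ʳ xs p)

module _ (Sg : Signature) where
  open Terms Sg

  private variable
    Γ Γ' Γ₁ Δ D Θ Θc B₁ B₂ L L' σs : Ctx
    τ ρ T : Type
    a a' a'' : Sort

  liftR-∈-++⁺ˡ : ∀ σs (r : Ren Γ Γ') (p : τ ∈ Γ) → liftR σs r (∈-++⁺ˡ p) ≡ ∈-++⁺ˡ (r p)
  liftR-∈-++⁺ˡ {Γ} σs r p rewrite ++⁻∘++⁺ Γ {σs} (inj₁ p) = refl

  liftR-∈-++⁺ʳ : ∀ σs (r : Ren Γ Γ') (p : τ ∈ σs) → liftR σs r (∈-++⁺ʳ Γ p) ≡ ∈-++⁺ʳ Γ' p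
  liftR-∈-++⁺ʳ {Γ} σs r p rewrite ++⁻∘++⁺ Γ {σs} (inj₂ p) = refl

  var-injective : {p q : τ ∈ Γ} → Head.var p ≡ var q → p ≡ q
  var-injective refl = refl

  lam-injective : {b b' : Body (Γ ++ dom τ) (cod τ)} → lam {τ = τ} b ≡ lam b' → b ≡ b'
  lam-injective refl = refl

  app-injective : {h : Head Γ (L ⇒ a)} {h' : Head Γ (L' ⇒ a)} {as : Args Γ L} {as' : Args Γ L'} →
                  app h as ≡ app h' as' →
                  Σ (L ≡ L') λ e → subst (λ L → Head Γ (L ⇒ a)) e h ≡ h' × subst (Args Γ) e as ≡ as'
  app-injective refl = refl , refl , refl

  ∷-injective : {t t' : Nf Γ ρ} {ts ts' : Args Γ L} → _≡_ {A = Args Γ (ρ ∷ L)} (t ∷ ts) (t' ∷ ts') →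
                t ≡ t' × ts ≡ ts'
  ∷-injective refl = refl , refl

  data Rigid {Γ} : ∀ {T} → Head Γ T → Set where
    free : ∀ v → Rigid (free v)
    fun  : ∀ f → Rigid (fun f)

  relocate : {h : Head Γ T} → Rigid h → Head Γ' T
  relocate (free v) = free v
  relocate (fun f)  = fun f

  -- Stated for an arbitrary x ≡ renH e₂ h: heads free v and free v′ of one type cannot be
  -- compared by pattern matching, as vty v ≟ vty v′ is stuck.
  renH-rigid : (h : Head D T) {e₂ : Ren D B₂} {e₁ : Ren D B₁} {x : Head B₂ T} →
               x ≡ renH e₂ h → (r : Rigid x) → relocate r ≡ renH e₁ h
  renH-rigid (free v) refl (free .v) = refl
  renH-rigid (fun f)  refl (fun .f)  = refl

  Compatible : Ren Θc B₁ → Ren Θc B₂ → Ren D B₁ → Ren D B₂ → Set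
  Compatible {Θc} {D = D} r₁ r₂ e₁ e₂ = ∀ {τ} (q : τ ∈ Θc) (p : τ ∈ D) → r₂ q ≡ e₂ p → r₁ q ≡ e₁ p

  module _ {r₁ : Ren Θc B₁} {r₂ : Ren Θc B₂} {e₁ : Ren D B₁} {e₂ : Ren D B₂} where

    compatible-liftR : ∀ σs → Compatible r₁ r₂ e₁ e₂ →
                       Compatible (liftR σs r₁) (liftR σs r₂) (liftR σs e₁) (liftR σs e₂)
    compatible-liftR σs c q p eq with appendView Θc q | appendView D p
    ... | inˡ q | inˡ p
      rewrite liftR-∈-++⁺ˡ σs r₁ q | liftR-∈-++⁺ˡ σs r₂ q | liftR-∈-++⁺ˡ σs e₁ p | liftR-∈-++⁺ˡ σs e₂ p
      = cong ∈-++⁺ˡ (c q p (∈-++⁺ˡ-injective eq))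
    ... | inˡ q | inʳ p rewrite liftR-∈-++⁺ˡ σs r₂ q | liftR-∈-++⁺ʳ σs e₂ p = ⊥-elim (∈-++⁺ˡ≢∈-++⁺ʳ eq)
    ... | inʳ q | inˡ p rewrite liftR-∈-++⁺ʳ σs r₂ q | liftR-∈-++⁺ˡ σs e₂ p = ⊥-elim (∈-++⁺ˡ≢∈-++⁺ʳ (sym eq))
    ... | inʳ q | inʳ p
      rewrite liftR-∈-++⁺ʳ σs r₁ q | liftR-∈-++⁺ʳ σs r₂ q | liftR-∈-++⁺ʳ σs e₁ p | liftR-∈-++⁺ʳ σs e₂ p
      = cong (∈-++⁺ʳ B₁) (∈-++⁺ʳ-injective B₂ eq)

    renH-compatible : Compatible r₁ r₂ e₁ e₂ → (h : Head Θc T) (h' : Head D T) →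
                      renH r₂ h ≡ renH e₂ h' → renH r₁ h ≡ renH e₁ h'
    renH-compatible c (var q)  (var p)  eq = cong var (c q p (var-injective eq))
    renH-compatible c (free v) h'       eq = renH-rigid h' eq (free v)
    renH-compatible c (fun f)  h'       eq = renH-rigid h' eq (fun f)

  mutual
    renN-compatible : {r₁ : Ren Θc B₁} {r₂ : Ren Θc B₂} {e₁ : Ren D B₁} {e₂ : Ren D B₂} →
                      Compatible r₁ r₂ e₁ e₂ → (x : Nf Θc τ) (z : Nf D τ) →
                      renN r₂ x ≡ renN e₂ z → renN r₁ x ≡ renN e₁ z
    renN-compatible {τ = τ} c (lam x) (lam z) eq =
      cong lam (renB-compatible (compatible-liftR (dom τ) c) x z (lam-injective eq))

    renB-compatible : {r₁ : Ren Θc B₁} {r₂ : Ren Θc B₂} {e₁ : Ren D B₁} {e₂ : Ren D B₂} →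
                      Compatible r₁ r₂ e₁ e₂ → (x : Body Θc a) (z : Body D a) →
                      renB r₂ x ≡ renB e₂ z → renB r₁ x ≡ renB e₁ z
    renB-compatible c (app h xs) (app h' zs) eq with app-injective eq
    ... | refl , eh , exs = cong₂ app (renH-compatible c h h' eh) (renA-compatible c xs zs exs)

    renA-compatible : {r₁ : Ren Θc B₁} {r₂ : Ren Θc B₂} {e₁ : Ren D B₁} {e₂ : Ren D B₂} →
                      Compatible r₁ r₂ e₁ e₂ → (xs : Args Θc L) (zs : Args D L) →
                      renA r₂ xs ≡ renA e₂ zs → renA r₁ xs ≡ renA e₁ zs
    renA-compatible c []       []       eq = refl
    renA-compatible c (x ∷ xs) (z ∷ zs) eq with ∷-injective eq
    ... | ex , exs = cong₂ _∷_ (renN-compatible c x z ex) (renA-compatible c xs zs exs)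

  headIs-renH⁻ : (r : Ren Γ Γ') (h : Head Γ T) {y : τ ∈ Γ'} →
                 HeadIs (renH r h) (bnd y) → Σ (τ ∈ Γ) λ x → r x ≡ y × HeadIs h (bnd x)
  headIs-renH⁻ r (var x) isVar = x , refl , isVar

  headIs-renH⁺ : (r : Ren Γ Γ') {h : Head Γ T} {x : τ ∈ Γ} →
                 HeadIs h (bnd x) → HeadIs (renH r h) (bnd (r x))
  headIs-renH⁺ r isVar = isVar

  mutual
    ∈B-renB⁻ : (r : Ren Γ Γ') (b : Body Γ a) {y : τ ∈ Γ'} →
               bnd y ∈B renB r b → Σ (τ ∈ Γ) λ x → r x ≡ y × bnd x ∈B b
    ∈B-renB⁻ r (app h xs) (inHead hy) = map₂ (map₂ inHead) (headIs-renH⁻ r h hy)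
    ∈B-renB⁻ r (app h xs) (inArgs y∈) = map₂ (map₂ inArgs) (∈A-renA⁻ r xs y∈)

    ∈A-renA⁻ : (r : Ren Γ Γ') (xs : Args Γ L) {y : τ ∈ Γ'} →
               bnd y ∈A renA r xs → Σ (τ ∈ Γ) λ x → r x ≡ y × bnd x ∈A xs
    ∈A-renA⁻ {Γ} r (_∷_ {ρ = ρ} (lam b) xs) (here y∈) with ∈B-renB⁻ (liftR (dom ρ) r) b y∈
    ... | x , eq , x∈ with appendView Γ x
    ...   | inˡ x = x , ∈-++⁺ˡ-injective (trans (sym (liftR-∈-++⁺ˡ (dom ρ) r x)) eq) , here x∈
    ...   | inʳ z = ⊥-elim (∈-++⁺ˡ≢∈-++⁺ʳ (trans (sym eq) (liftR-∈-++⁺ʳ (dom ρ) r z)))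
    ∈A-renA⁻ r (x ∷ xs) (there y∈) = map₂ (map₂ there) (∈A-renA⁻ r xs y∈)

  mutual
    ∈B-renB⁺ : (r : Ren Γ Γ') {b : Body Γ a} {x : τ ∈ Γ} → bnd x ∈B b → bnd (r x) ∈B renB r b
    ∈B-renB⁺ r (inHead hx) = inHead (headIs-renH⁺ r hx)
    ∈B-renB⁺ r (inArgs x∈) = inArgs (∈A-renA⁺ r x∈)

    ∈A-renA⁺ : (r : Ren Γ Γ') {xs : Args Γ L} {x : τ ∈ Γ} → bnd x ∈A xs → bnd (r x) ∈A renA r xs
    ∈A-renA⁺ r {x = x} (here {ρ = ρ} x∈) =
      here (subst (λ y → bnd y ∈B _) (liftR-∈-++⁺ˡ (dom ρ) r x) (∈B-renB⁺ (liftR (dom ρ) r) x∈))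
    ∈A-renA⁺ r (there x∈) = there (∈A-renA⁺ r x∈)

  ∈A-++⁻ : {z : Var Γ} (xs : Args Γ L) {ys : Args Γ L'} → z ∈A (xs ++A ys) → z ∈A xs ⊎ z ∈A ys
  ∈A-++⁻ []       z∈         = inj₂ z∈
  ∈A-++⁻ (x ∷ xs) (here z∈)  = inj₁ (here z∈)
  ∈A-++⁻ (x ∷ xs) (there z∈) with ∈A-++⁻ xs z∈
  ... | inj₁ z∈xs = inj₁ (there z∈xs)
  ... | inj₂ z∈ys = inj₂ z∈ys

  ∈A-++⁺ˡ : {z : Var Γ} {xs : Args Γ L} {ys : Args Γ L'} → z ∈A xs → z ∈A (xs ++A ys)
  ∈A-++⁺ˡ (here z∈)  = here z∈
  ∈A-++⁺ˡ (there z∈) = there (∈A-++⁺ˡ z∈)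

  mutual
    eta-high : ∀ {k} (y : τ ∈ Γ) {x : ρ ∈ Γ ++ dom τ} → k ≤ length Γ → k ≤ pos y →
               bnd x ∈B bodyOf (eta τ y) → k ≤ pos x
    eta-high {τ = _ ⇒ _} y k≤Γ k≤y (inHead isVar) = subst (_ ≤_) (sym (pos-∈-++⁺ˡ y)) k≤y
    eta-high {τ = ρs ⇒ _} {Γ = Γ} y k≤Γ k≤y (inArgs x∈) =
      etas-high ρs (∈-++⁺ʳ Γ) (≤-trans k≤Γ (length-++-≤ˡ Γ))
                (λ w → ≤-trans k≤Γ (length≤pos-∈-++⁺ʳ Γ w)) x∈

    etas-high : ∀ {k} σs (f : ∀ {σ} → σ ∈ σs → σ ∈ Γ) {x : ρ ∈ Γ} → k ≤ length Γ →
                (∀ {σ} (w : σ ∈ σs) → k ≤ pos (f w)) → bnd x ∈A etas σs f → k ≤ pos x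
    etas-high ((_ ⇒ _) ∷ σs) f {x} k≤Γ high (here x∈) =
      subst (_ ≤_) (pos-∈-++⁺ˡ x) (eta-high (f (here refl)) k≤Γ (high (here refl)) x∈)
    etas-high (σ ∷ σs) f k≤Γ high (there x∈) =
      etas-high σs (λ w → f (there w)) k≤Γ (λ w → high (there w)) x∈

  renH-var⁻ : (r : Ren Γ Γ') (h : Head Γ T) {y : T ∈ Γ'} → var y ≡ renH r h → Σ (T ∈ Γ) λ x → r x ≡ y
  renH-var⁻ r (var x) eq = x , sym (var-injective eq)

  eta-renN⁻ : (r : Ren Γ Γ') (t : Nf Γ τ) {y : τ ∈ Γ'} → eta τ y ≡ renN r t → Σ (τ ∈ Γ) λ x → r x ≡ y
  eta-renN⁻ {Γ} {τ = ρs ⇒ _} r (lam (app h ts)) eq with app-injective (lam-injective eq)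
  ... | refl , eh , _ with renH-var⁻ (liftR ρs r) h eh
  ...   | x , ex with appendView Γ x
  ...     | inˡ x = x , ∈-++⁺ˡ-injective (trans (sym (liftR-∈-++⁺ˡ ρs r x)) ex)
  ...     | inʳ z = ⊥-elim (∈-++⁺ˡ≢∈-++⁺ʳ (trans (sym ex) (liftR-∈-++⁺ʳ ρs r z)))

  mutual
    ⊵-trans : {b : Body Γ a} {b' : Body Γ' a'} {b'' : Body D a''} → b ⊵ b' → b' ⊵ b'' → b ⊵ b''
    ⊵-trans ⊵-refl     d' = d'
    ⊵-trans (⊵-arg xs) d' = ⊵-arg (argSub-⊵ xs d')

    argSub-⊵ : {xs : Args Γ L} {b' : Body Γ' a'} {b'' : Body D a''} → ArgSub xs b' → b' ⊵ b'' → ArgSub xs b''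
    argSub-⊵ (here d)   d' = here (⊵-trans d d')
    argSub-⊵ (there xs) d' = there (argSub-⊵ xs d')

  data LowVar (k : ℕ) {Γ} (P : Var Γ → Set) : Set where
    lowVar : (x : τ ∈ Γ) → pos x < k → P (bnd x) → LowVar k P

  mutual
    ⊵-lowVar : ∀ {k} {b : Body Γ a} {b' : Body Γ' a'} → k ≤ length Γ → b ⊵ b' →
               LowVar k (_∈B b') → LowVar k (_∈B b)
    ⊵-lowVar k≤Γ ⊵-refl     x = x
    ⊵-lowVar k≤Γ (⊵-arg xs) x with argSub-lowVar k≤Γ xs x
    ... | lowVar y y<k y∈ = lowVar y y<k (inArgs y∈)

    argSub-lowVar : ∀ {k} {xs : Args Γ L} {b' : Body Γ' a'} → k ≤ length Γ → ArgSub xs b' →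
                    LowVar k (_∈B b') → LowVar k (_∈A xs)
    argSub-lowVar {Γ = Γ} k≤Γ (here {ρ = ρ} d) x with ⊵-lowVar (≤-trans k≤Γ (length-++-≤ˡ Γ)) d x
    ... | lowVar y y<k y∈ with appendView Γ y
    ...   | inˡ y = lowVar y (subst (_< _) (pos-∈-++⁺ˡ y) y<k) (here y∈)
    ...   | inʳ z = ⊥-elim (<⇒≱ y<k (≤-trans k≤Γ (length≤pos-∈-++⁺ʳ Γ z)))
    argSub-lowVar k≤Γ (there xs) x with argSub-lowVar k≤Γ xs x
    ... | lowVar y y<k y∈ = lowVar y y<k (there y∈)

  -- x₁…x_{n'}.h(t₁,…,t_{m+k}) in the definition of ⊵E, with D = x_{n+1}…x_{n'}
  weakenedApp : Head Δ ((L ++ σs) ⇒ a) → Args Δ L → ∀ D → Args (Δ ++ D) σs → Body (Δ ++ D) a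
  weakenedApp hd as D rest = app (renH (wk D) hd) (renA (wk D) as ++A rest)

  ContainsApp : Body Γ a' → Head Δ ((L ++ σs) ⇒ a) → Args Δ L → Set
  ContainsApp {Δ = Δ} {σs = σs} b hd as = ∃₂ λ D (rest : Args (Δ ++ D) σs) → b ⊵ weakenedApp hd as D rest

  ⊵-containsApp : {b : Body Γ a'} {b' : Body Γ' a''} {hd : Head Δ ((L ++ σs) ⇒ a)} {as : Args Δ L} →
                  b ⊵ b' → ContainsApp b' hd as → ContainsApp b hd as
  ⊵-containsApp d = map₂ (map₂ (⊵-trans d))

  AgreeBelow : ℕ → Ren Θc Γ₁ → Ren Θc Θ → Set
  AgreeBelow {Θc} k r₁ r₂ = ∀ {τ} (q : τ ∈ Θc) → pos (r₂ q) < k → pos (r₁ q) ≡ pos (r₂ q)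

  -- r₂ and r₁ place a common subterm into the body of t and into that of s. Both target contexts
  -- start with x⃗ = Δ (for t only the length matters), and r₁ sends to xᵢ whatever r₂ sends to xᵢ.
  record Parallel (Δ : Ctx) (r₁ : Ren Θc Γ₁) (r₂ : Ren Θc Θ) : Set where
    field
      extension₁ : ∃ λ Δ₁ → Δ ++ Δ₁ ≡ Γ₁
      length₂    : length Δ ≤ length Θ
      agree      : AgreeBelow (length Δ) r₁ r₂

  parallel-liftR : ∀ σs {r₁ : Ren Θc Γ₁} {r₂ : Ren Θc Θ} →
                   Parallel Δ r₁ r₂ → Parallel Δ (liftR σs r₁) (liftR σs r₂)
  parallel-liftR {Θc} {Θ = Θ} {Δ} σs {r₁} {r₂}
                 record { extension₁ = Δ₁ , refl ; length₂ = Δ≤Θ ; agree = agree } =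
    record { extension₁ = Δ₁ ++ σs , sym (++-assoc Δ Δ₁ σs)
           ; length₂    = ≤-trans Δ≤Θ (length-++-≤ˡ Θ)
           ; agree      = agree-liftR }
    where
    agree-liftR : AgreeBelow (length Δ) (liftR σs r₁) (liftR σs r₂)
    agree-liftR q q< with appendView Θc q
    ... | inˡ q rewrite liftR-∈-++⁺ˡ σs r₁ q | liftR-∈-++⁺ˡ σs r₂ q
                      | pos-∈-++⁺ˡ {ys = σs} (r₁ q) | pos-∈-++⁺ˡ {ys = σs} (r₂ q) = agree q q<
    ... | inʳ w rewrite liftR-∈-++⁺ʳ σs r₂ w = ⊥-elim (<⇒≱ q< (≤-trans Δ≤Θ (length≤pos-∈-++⁺ʳ Θ w)))

  agreeBelow-compatible : ∀ {Δ₁} {r₁ : Ren Θc (Δ ++ Δ₁)} {r₂ : Ren Θc (Δ ++ D)} →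
                          AgreeBelow (length Δ) r₁ r₂ → Compatible r₁ r₂ (wk Δ₁) (wk D)
  agreeBelow-compatible {Δ = Δ} {r₁ = r₁} {r₂} agree q p eq = pos-injective (begin
    pos (r₁ q)         ≡⟨ agree q (subst (_< length Δ) (sym r₂q≡p) (pos<length p)) ⟩
    pos (r₂ q)         ≡⟨ r₂q≡p ⟩
    pos p              ≡⟨ pos-∈-++⁺ˡ p ⟨
    pos (∈-++⁺ˡ p)     ∎)
    where
    open ≡-Reasoning
    r₂q≡p : pos (r₂ q) ≡ pos p
    r₂q≡p = trans (cong pos eq) (pos-∈-++⁺ˡ p)

  -- Arguments of corresponding applications in the bodies of t (as₂) and of s (as₁): a common
  -- subterm on both sides, or an η-expanded variable outside x⃗ opposite an arbitrary term.
  data Agree (Δ : Ctx) {Θc Γ₁ Θ} (r₁ : Ren Θc Γ₁) (r₂ : Ren Θc Θ) : ∀ {L} → Args Θ L → Args Γ₁ L → Set where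
    []         : Agree Δ r₁ r₂ [] []
    renamed    : ∀ {ρ L} {as₂ : Args Θ L} {as₁ : Args Γ₁ L} (x : Nf Θc ρ) →
                 Agree Δ r₁ r₂ as₂ as₁ → Agree Δ r₁ r₂ (renN r₂ x ∷ as₂) (renN r₁ x ∷ as₁)
    η-expanded : ∀ {ρ L} {as₂ : Args Θ L} {as₁ : Args Γ₁ L} (y : ρ ∈ Θ) → length Δ ≤ pos y →
                 (t : Nf Γ₁ ρ) → Agree Δ r₁ r₂ as₂ as₁ → Agree Δ r₁ r₂ (eta ρ y ∷ as₂) (t ∷ as₁)

  module _ {r₁ : Ren Θc Γ₁} {r₂ : Ren Θc Θ} where

    agree-renA : (xs : Args Θc L) → Agree Δ r₁ r₂ (renA r₂ xs) (renA r₁ xs)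
    agree-renA []       = []
    agree-renA (x ∷ xs) = renamed x (agree-renA xs)

    agree-etas : (f : ∀ {σ} → σ ∈ σs → σ ∈ Θ) → (∀ {σ} (w : σ ∈ σs) → length Δ ≤ pos (f w)) →
                 (ts : Args Γ₁ σs) → Agree Δ r₁ r₂ (etas σs f) ts
    agree-etas f high []       = []
    agree-etas f high (t ∷ ts) =
      η-expanded (f (here refl)) (high (here refl)) t
                 (agree-etas (λ w → f (there w)) (λ w → high (there w)) ts)

    agree-++ : {as₂ : Args Θ L} {as₁ : Args Γ₁ L} {bs₂ : Args Θ L'} {bs₁ : Args Γ₁ L'} →
               Agree Δ r₁ r₂ as₂ as₁ → Agree Δ r₁ r₂ bs₂ bs₁ → Agree Δ r₁ r₂ (as₂ ++A bs₂) (as₁ ++A bs₁)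
    agree-++ []                       bs = bs
    agree-++ (renamed x as)           bs = renamed x (agree-++ as bs)
    agree-++ (η-expanded y high t as) bs = η-expanded y high t (agree-++ as bs)

  agree-prefix : ∀ {Δ₁} {r₁ : Ren Θc (Δ ++ Δ₁)} {r₂ : Ren Θc (Δ ++ D)} →
                 Compatible r₁ r₂ (wk Δ₁) (wk D) → (xs : Args Δ L) {rest : Args (Δ ++ D) σs}
                 {as₂ : Args (Δ ++ D) (L ++ σs)} {as₁ : Args (Δ ++ Δ₁) (L ++ σs)} →
                 Agree Δ r₁ r₂ as₂ as₁ → as₂ ≡ renA (wk D) xs ++A rest →
                 ∃ λ rest₁ → as₁ ≡ renA (wk Δ₁) xs ++A rest₁
  agree-prefix c [] {as₁ = as₁} _ _ = as₁ , refl
  agree-prefix c (x ∷ xs) (renamed y ag) eq with ∷-injective eq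
  ... | ex , exs with agree-prefix c xs ag exs
  ...   | rest₁ , refl = rest₁ , cong (_∷ _) (renN-compatible c y x ex)
  agree-prefix {D = D} c (x ∷ xs) (η-expanded y high _ _) eq
    with eta-renN⁻ (wk D) x (proj₁ (∷-injective eq))
  ... | q , refl = ⊥-elim (<⇒≱ (pos-∈-++⁺ˡ<length q) high)

  module _ {Δ D : Ctx} {L σs a} (hd : Head Δ ((L ++ σs) ⇒ a)) (as : Args Δ L)
           (rest : Args (Δ ++ D) σs) (x∈U : LowVar (length Δ) (_∈B weakenedApp hd as D rest)) where

    private
      U : Body (Δ ++ D) a
      U = weakenedApp hd as D rest

    refl-transport : {r₁ : Ren Θc Γ₁} {r₂ : Ren Θc (Δ ++ D)} → Parallel Δ r₁ r₂ →
                     (h : Head Θc (L' ⇒ a)) {as₂ : Args (Δ ++ D) L'} {as₁ : Args Γ₁ L'} →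
                     Agree Δ r₁ r₂ as₂ as₁ → U ≡ app (renH r₂ h) as₂ →
                     ContainsApp (app (renH r₁ h) as₁) hd as
    refl-transport record { extension₁ = Δ₁ , refl ; agree = agree } h ag eq with app-injective eq
    ... | refl , eh , eas with agree-prefix (agreeBelow-compatible agree) as ag (sym eas)
    ...   | rest₁ , refl rewrite renH-compatible (agreeBelow-compatible agree) h hd (sym eh) =
      Δ₁ , rest₁ , ⊵-refl

    mutual
      -- b is kept apart from its shape so that ⊵-refl can be matched against U.
      ⊵-transport : {r₁ : Ren Θc Γ₁} {r₂ : Ren Θc Θ} → Parallel Δ r₁ r₂ →
                    (h : Head Θc (L' ⇒ a')) {as₂ : Args Θ L'} {as₁ : Args Γ₁ L'} →
                    Agree Δ r₁ r₂ as₂ as₁ → (b : Body Θ a') → b ≡ app (renH r₂ h) as₂ → b ⊵ U →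
                    ContainsApp (app (renH r₁ h) as₁) hd as
      ⊵-transport par h ag _ eq   ⊵-refl      = refl-transport par h ag eq
      ⊵-transport par h ag _ refl (⊵-arg sub) = map₂ (map₂ ⊵-arg) (argSub-transport par ag sub)

      argSub-transport : {r₁ : Ren Θc Γ₁} {r₂ : Ren Θc Θ} → Parallel Δ r₁ r₂ →
                         {as₂ : Args Θ L'} {as₁ : Args Γ₁ L'} → Agree Δ r₁ r₂ as₂ as₁ → ArgSub as₂ U →
                         ∃₂ λ D₁ rest₁ → ArgSub as₁ (weakenedApp hd as D₁ rest₁)
      argSub-transport par (renamed {ρ = ρ} (lam (app h xs)) ag) (here d) =
        map₂ (map₂ here) (⊵-transport (parallel-liftR (dom ρ) par) h (agree-renA xs) _ refl d)
      argSub-transport {Θ = Θ} par (η-expanded {ρ = _ ⇒ _} y high _ _) (here d)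
        with ⊵-lowVar (≤-trans (Parallel.length₂ par) (length-++-≤ˡ Θ)) d x∈U
      ... | lowVar x x<Δ x∈ = ⊥-elim (<⇒≱ x<Δ (eta-high y (Parallel.length₂ par) high x∈))
      argSub-transport par (renamed _ ag) (there sub) =
        map₂ (map₂ there) (argSub-transport par ag sub)
      argSub-transport par (η-expanded _ _ _ ag) (there sub) =
        map₂ (map₂ there) (argSub-transport par ag sub)

  ∈B-weakenedApp : ∀ {D D'} (hd : Head Δ ((L ++ σs) ⇒ a)) (as : Args Δ L) {rest : Args (Δ ++ D) σs}
                   (rest' : Args (Δ ++ D') σs) {p : τ ∈ Δ} → ¬ bnd (∈-++⁺ˡ p) ∈A rest →
                   bnd (∈-++⁺ˡ p) ∈B weakenedApp hd as D rest → bnd (∈-++⁺ˡ p) ∈B weakenedApp hd as D' rest'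
  ∈B-weakenedApp {D' = D'} hd as rest' p∉rest (inHead hp) with headIs-renH⁻ (wk _) hd hp
  ... | x , ex , hx with ∈-++⁺ˡ-injective ex
  ...   | refl = inHead (headIs-renH⁺ (wk D') hx)
  ∈B-weakenedApp {D = D} {D'} hd as rest' p∉rest (inArgs p∈) with ∈A-++⁻ (renA (wk D) as) p∈
  ... | inj₂ p∈rest = ⊥-elim (p∉rest p∈rest)
  ... | inj₁ p∈as with ∈A-renA⁻ (wk D) as p∈as
  ...   | x , ex , x∈ with ∈-++⁺ˡ-injective ex
  ...     | refl = inArgs (∈A-++⁺ˡ (∈A-renA⁺ (wk D') x∈))

  ⊵E-trans : ∀ {τs τt τu} {s : Nf Δ τs} {t : Nf Δ τt} {u : Nf Δ τu} {p : τ ∈ Δ} →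
             s ⊵E t → t ⊵E u → bnd p ∈fv u → s ⊵E u
  ⊵E-trans {Δ} {τt = τt} {τu} {t = t} {p = p} (expForm _ hdt ast eqt , D₁ , rest₁ , s⊵)
           (eu@(expForm _ hdu asu equ) , D₂ , rest₂ , t⊵) p∈u =
    eu , ⊵-containsApp s⊵ (⊵-transport hdu asu rest₂ p∈U par hdt agree (bodyOf t) (cong bodyOf eqt) t⊵)
    where
    par : Parallel Δ (wk D₁) (wk (dom τt))
    par = record { extension₁ = D₁ , refl
                 ; length₂    = length-++-≤ˡ Δ
                 ; agree      = λ q _ → trans (pos-∈-++⁺ˡ q) (sym (pos-∈-++⁺ˡ q)) }

    agree : Agree Δ (wk D₁) (wk (dom τt)) (renA (wk (dom τt)) ast ++A etas (dom τt) (∈-++⁺ʳ Δ))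
                                          (renA (wk D₁) ast ++A rest₁)
    agree = agree-++ (agree-renA ast) (agree-etas (∈-++⁺ʳ Δ) (length≤pos-∈-++⁺ʳ Δ) rest₁)

    p∉etas : ¬ bnd (∈-++⁺ˡ p) ∈A etas (dom τu) (∈-++⁺ʳ Δ)
    p∉etas p∈ = <⇒≱ (pos-∈-++⁺ˡ<length p)
                    (etas-high (dom τu) (∈-++⁺ʳ Δ) (length-++-≤ˡ Δ) (length≤pos-∈-++⁺ʳ Δ) p∈)

    p∈U : LowVar (length Δ) (_∈B weakenedApp hdu asu D₂ rest₂)
    p∈U = lowVar (∈-++⁺ˡ p) (pos-∈-++⁺ˡ<length p)
                      (∈B-weakenedApp hdu asu rest₂ p∉etas (subst (bnd p ∈fv_) equ p∈u))

lemma9 : (Sg : Signature) → let open Terms Sg in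
    ∀ {Δ : Ctx} {τs τt τu : Type}
      (s : Nf Δ τs) (t : Nf Δ τt) (u : Nf Δ τu) →
      Expanded t → Expanded u →
      s ⊵E t → t ⊵E u →
      FvNonemptyInBinders t → FvNonemptyInBinders u →
      s ⊵E u
lemma9 Sg s t u _ _ s⊵t t⊵u _ ((Terms.bnd p , p∈u) , _)         = ⊵E-trans Sg {s = s} {t} {u} s⊵t t⊵u p∈u
lemma9 Sg s t u _ _ s⊵t t⊵u _ ((Terms.fre v , v∈u) , ⊆binders) = ⊥-elim (⊆binders (Terms.fre v) v∈u)
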